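{- Let $n\ge 2$. The set $\mathscr{F}_{n,3}$ is in bijection with the set $\{0,1\}^{n-2}=(\mathbb{Z}/2\mathbb{Z})^{n-2}$ of binary strings of length $n-2$; in particular $|\mathscr{F}_{n,3}|=2^{n-2}$.
   Context: DAGs have vertex set $[n+1]$ and a finite multiset of directed edges $(i,j)$ with $i<j$ (parallel edges allowed, counted with multiplicity), and are identified with their edge multisets. $\mathscr{F}_{n,3}$ is the set of such DAGs with out-degree sequence $(3,2,\dots,2,0)$ and in-degree sequence $(0,2,\dots,2,3)$. -}

module Defs where

open import Data.Nat using (ℕ; zero; suc; _≡ᵇ_)
open import Data.Bool using (Bool; if_then_else_)
open import Data.Fin using (Fin; toℕ; _<_; _≤_)
open import Data.Vec using (Vec; tabulate; sum)
open import Data.Product using (Σ; _×_; _,_)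
open import Relation.Binary.PropositionalEquality using (_≡_)

-- A DAG on vertex set [n+1] with edges (i,j), i<j, parallel edges allowed,
-- is identified with its edge multiset, i.e. a multiplicity function.
-- Vertex k ∈ [n+1] is represented by the index k-1 : Fin (suc n).
EdgeMult : ℕ → Set
EdgeMult n = Fin (suc n) → Fin (suc n) → ℕ

Acyclic : (n : ℕ) → EdgeMult n → Set
Acyclic n M = ∀ i j → j ≤ i → M i j ≡ 0

outdeg : (n : ℕ) → EdgeMult n → Fin (suc n) → ℕ
outdeg n M i = sum (tabulate (λ j → M i j))

indeg : (n : ℕ) → EdgeMult n → Fin (suc n) → ℕ
indeg n M j = sum (tabulate (λ i → M i j))

outSeq : (n : ℕ) → Fin (suc n) → ℕ
outSeq n i = if toℕ i ≡ᵇ 0 then 3 else (if toℕ i ≡ᵇ n then 0 else 2)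

inSeq : (n : ℕ) → Fin (suc n) → ℕ
inSeq n i = if toℕ i ≡ᵇ 0 then 0 else (if toℕ i ≡ᵇ n then 3 else 2)

IsF3 : (n : ℕ) → EdgeMult n → Set
IsF3 n M = Acyclic n M
         × (∀ i → outdeg n M i ≡ outSeq n i)
         × (∀ i → indeg n M i ≡ inSeq n i)

F3 : ℕ → Set
F3 n = Σ (EdgeMult n) (IsF3 n)

_≈F_ : {n : ℕ} → F3 n → F3 n → Set
_≈F_ (M , _) (M' , _) = ∀ i j → M i j ≡ M' i j

-- For 1 ≤ j ≤ n the edges from {0, …, j-1} to {j, …, n} number 3 (out-degrees minus in-degrees of an
-- initial segment), and inductively they are two edges leaving j - 1 and one leaving some earlier
-- vertex a.  A middle vertex j takes two of them, either both from j - 1 or one from j - 1 and one from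
-- a, and the last vertex takes all three.  So a graph in 𝓕_{n,3} is determined by the choices made at
-- the vertices 2, …, n-1 (at vertex 1 the options coincide, the three crossing edges all leaving 0),
-- and every sequence of choices occurs.  Uniqueness goes column by column: once the earlier columns
-- agree with the generated graph, the unused out-degrees bound the next column by the cut, and its
-- in-degree then leaves only the choices above.

module Submission where

open import Defs
open import Data.Nat using (ℕ; zero; suc; pred; _+_; _*_; _∸_; _≤_; _<_; z≤n; s≤s; _≡ᵇ_; _≟_; _<?_)
open import Data.Nat.Properties
open import Algebra.Properties.CommutativeSemigroup +-commutativeSemigroup using (interchange)
open import Data.Fin using (Fin; toℕ)
import Data.Fin as Fin
import Data.Fin.Properties as Finₚ
open import Data.Vec using (Vec; []; _∷_; tabulate; sum)
import Data.Vec.Properties as Vecₚ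
open import Data.Bool using (Bool; true; false; if_then_else_)
open import Data.Product using (Σ; _×_; ∃; _,_; proj₁)
open import Data.Sum using (inj₁; inj₂)
open import Function using (_∘_)
open import Data.Nat.Tactic.RingSolver using (solve-∀)
open import Relation.Binary.PropositionalEquality
open import Relation.Nullary using (yes; no; contradiction)
open import Relation.Nullary.Decidable using (dec-true; dec-false)

∑ : ℕ → (ℕ → ℕ) → ℕ
∑ zero    f = 0
∑ (suc j) f = ∑ j f + f j

∑-cong : ∀ j {f g} → (∀ k → k < j → f k ≡ g k) → ∑ j f ≡ ∑ j g
∑-cong zero    f≡g = refl
∑-cong (suc j) f≡g = cong₂ _+_ (∑-cong j (λ k k<j → f≡g k (m<n⇒m<1+n k<j))) (f≡g j (n<1+n j))

∑-zero : ∀ j {f} → (∀ k → k < j → f k ≡ 0) → ∑ j f ≡ 0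
∑-zero zero    f≡0 = refl
∑-zero (suc j) f≡0 = cong₂ _+_ (∑-zero j (λ k k<j → f≡0 k (m<n⇒m<1+n k<j))) (f≡0 j (n<1+n j))

∑-+ : ∀ j f g → ∑ j (λ k → f k + g k) ≡ ∑ j f + ∑ j g
∑-+ zero    f g = refl
∑-+ (suc j) f g = trans (cong (_+ (f j + g j)) (∑-+ j f g)) (interchange (∑ j f) (∑ j g) (f j) (g j))

∑-*ˡ : ∀ j c f → ∑ j (λ k → c * f k) ≡ c * ∑ j f
∑-*ˡ zero    c f = sym (*-zeroʳ c)
∑-*ˡ (suc j) c f = trans (cong (_+ c * f j) (∑-*ˡ j c f)) (sym (*-distribˡ-+ c (∑ j f) (f j)))

∑-head : ∀ j f → ∑ (suc j) f ≡ f 0 + ∑ j (f ∘ suc)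
∑-head zero    f = +-comm 0 (f 0)
∑-head (suc j) f = trans (cong (_+ f (suc j)) (∑-head j f)) (+-assoc (f 0) (∑ j (f ∘ suc)) (f (suc j)))

∑-mono-≤ : ∀ j {f g} → (∀ k → k < j → f k ≤ g k) → ∑ j f ≤ ∑ j g
∑-mono-≤ zero    f≤g = z≤n
∑-mono-≤ (suc j) f≤g = +-mono-≤ (∑-mono-≤ j (λ k k<j → f≤g k (m<n⇒m<1+n k<j))) (f≤g j (n<1+n j))

∑-tight : ∀ j {f g} → (∀ k → k < j → f k ≤ g k) → ∑ j g ≤ ∑ j f → ∀ k → k < j → f k ≡ g k
∑-tight (suc j) {f} {g} f≤g Σg≤Σf k k<1+j with m<1+n⇒m<n∨m≡n k<1+j
... | inj₁ k<j  = ∑-tight j (λ k k<j → f≤g k (m<n⇒m<1+n k<j)) Σg≤Σf′ k k<j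
  where
  Σg≤Σf′ : ∑ j g ≤ ∑ j f
  Σg≤Σf′ = +-cancelʳ-≤ (g j) (∑ j g) (∑ j f) (≤-trans Σg≤Σf (+-monoʳ-≤ (∑ j f) (f≤g j (n<1+n j))))
... | inj₂ refl = ≤-antisym (f≤g j (n<1+n j)) gj≤fj
  where
  gj≤fj : g j ≤ f j
  gj≤fj = +-cancelˡ-≤ (∑ j g) (g j) (f j)
            (≤-trans Σg≤Σf (+-monoˡ-≤ (f j) (∑-mono-≤ j (λ k k<j → f≤g k (m<n⇒m<1+n k<j)))))

∑-prefix-≤ : ∀ {j} N f → j ≤ N → ∑ j f ≤ ∑ N f
∑-prefix-≤ {zero}  zero    f _  = z≤n
∑-prefix-≤ {j}     (suc N) f j≤1+N with m≤n⇒m<n∨m≡n j≤1+N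
... | inj₁ j≤N  = ≤-trans (∑-prefix-≤ N f (≤-pred j≤N)) (m≤m+n (∑ N f) (f N))
... | inj₂ refl = ≤-refl

∑-prefix : ∀ {j} N f → j ≤ N → (∀ k → j ≤ k → k < N → f k ≡ 0) → ∑ N f ≡ ∑ j f
∑-prefix {zero}  zero    f _     _   = refl
∑-prefix {j}     (suc N) f j≤1+N f≡0 with m≤n⇒m<n∨m≡n j≤1+N
... | inj₁ j≤N  = begin
  ∑ N f + f N ≡⟨ cong (∑ N f +_) (f≡0 N (≤-pred j≤N) (n<1+n N)) ⟩
  ∑ N f + 0   ≡⟨ +-identityʳ (∑ N f) ⟩
  ∑ N f       ≡⟨ ∑-prefix N f (≤-pred j≤N) (λ k j≤k k<N → f≡0 k j≤k (m<n⇒m<1+n k<N)) ⟩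
  ∑ j f       ∎
  where open ≡-Reasoning
... | inj₂ refl = refl

∑-tabulate : ∀ m (g : ℕ → ℕ) → sum (tabulate {n = m} (g ∘ toℕ)) ≡ ∑ m g
∑-tabulate zero    g = refl
∑-tabulate (suc m) g = trans (cong (g 0 +_) (∑-tabulate m (g ∘ suc))) (sym (∑-head m g))

δ : ℕ → ℕ → ℕ
δ p k = if k ≡ᵇ p then 1 else 0

δ-same : ∀ p → δ p p ≡ 1
δ-same p = cong (if_then 1 else 0) (dec-true (p ≟ p) refl)

δ-other : ∀ {p k} → k ≢ p → δ p k ≡ 0
δ-other {p} {k} k≢p = cong (if_then 1 else 0) (dec-false (k ≟ p) k≢p)

∑-δ : ∀ {p} j → p < j → ∑ j (δ p) ≡ 1
∑-δ {p} j p<j = begin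
  ∑ j (δ p)         ≡⟨ ∑-prefix j (δ p) p<j (λ k p<k _ → δ-other (>⇒≢ p<k)) ⟩
  ∑ p (δ p) + δ p p ≡⟨ cong₂ _+_ (∑-zero p (λ k k<p → δ-other (<⇒≢ k<p))) (δ-same p) ⟩
  1                 ∎
  where open ≡-Reasoning

-- A middle vertex takes two of the three crossing edges δ q + 2 δ p: both from p (true) or one
-- each from p and q (false); next b p q is the vertex then left with one crossing edge.
step : Bool → ℕ → ℕ → ℕ → ℕ
step true  p q k = 2 * δ p k
step false p q k = δ p k + δ q k

next : Bool → ℕ → ℕ → ℕ
next true  p q = q
next false p q = p

next-≤ : ∀ b {p q j} → p ≤ j → q ≤ j → next b p q ≤ j
next-≤ true  _   q≤j = q≤j
next-≤ false p≤j _   = p≤j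

step-+-next : ∀ b p q k → step b p q k + δ (next b p q) k ≡ δ q k + 2 * δ p k
step-+-next true  p q k = +-comm (2 * δ p k) (δ q k)
step-+-next false p q k = [x+y]+x≡y+2x (δ p k) (δ q k)
  where
  [x+y]+x≡y+2x : ∀ x y → (x + y) + x ≡ y + 2 * x
  [x+y]+x≡y+2x = solve-∀

step-zero : ∀ b {p q k} → k ≢ p → k ≢ q → step b p q k ≡ 0
step-zero true  k≢p _   = cong (2 *_) (δ-other k≢p)
step-zero false k≢p k≢q = cong₂ _+_ (δ-other k≢p) (δ-other k≢q)

step-same : ∀ b p → step b p p p ≡ 2
step-same true  p = cong (2 *_) (δ-same p)
step-same false p = cong₂ _+_ (δ-same p) (δ-same p)

step-readback : ∀ b {p q} → q ≢ p → (step b p q p ≡ᵇ 2) ≡ b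
step-readback true  {p}     _   = cong (λ x → 2 * x ≡ᵇ 2) (δ-same p)
step-readback false {p} {q} q≢p = cong₂ (λ x y → x + y ≡ᵇ 2) (δ-same p) (δ-other (≢-sym q≢p))

∑-step : ∀ b {p q} j → p < j → q < j → ∑ j (step b p q) ≡ 2
∑-step true  {p}     j p<j _   = trans (∑-*ˡ j 2 (δ p)) (cong (2 *_) (∑-δ j p<j))
∑-step false {p} {q} j p<j q<j = trans (∑-+ j (δ p) (δ q)) (cong₂ _+_ (∑-δ j p<j) (∑-δ j q<j))

step-of-≤-cut : ∀ {j p q f} → p < j → q < p → (∀ k → k < j → f k ≤ δ q k + 2 * δ p k) →
                ∑ j f ≡ 2 → ∀ k → k < j → f k ≡ step (f p ≡ᵇ 2) p q k
step-of-≤-cut {j} {p} {q} {f} p<j q<p f≤cut Σf≡2 = by-value (f p) refl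
  where
  q<j : q < j
  q<j = <-trans q<p p<j

  f≤δq-off-p : ∀ {k} → k < j → k ≢ p → f k ≤ δ q k
  f≤δq-off-p {k} k<j k≢p =
    subst (f k ≤_) (trans (cong (λ x → δ q k + 2 * x) (δ-other k≢p)) (+-identityʳ (δ q k))) (f≤cut k k<j)

  fp≤2 : f p ≤ 2
  fp≤2 = subst (f p ≤_) (cong₂ (λ x y → x + 2 * y) (δ-other (>⇒≢ q<p)) (δ-same p)) (f≤cut p p<j)

  by-value : ∀ x → f p ≡ x → ∀ k → k < j → f k ≡ step (x ≡ᵇ 2) p q k
  by-value 0 fp≡0 = contradiction (≤-trans (≤-reflexive (sym Σf≡2)) Σf≤1) λ { (s≤s ()) }
    where
    f≤δq : ∀ k → k < j → f k ≤ δ q k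
    f≤δq k k<j with k ≟ p
    ... | yes refl = subst (_≤ δ q k) (sym fp≡0) z≤n
    ... | no k≢p   = f≤δq-off-p k<j k≢p
    Σf≤1 : ∑ j f ≤ 1
    Σf≤1 = ≤-trans (∑-mono-≤ j f≤δq) (≤-reflexive (∑-δ j q<j))
  by-value 1 fp≡1 = ∑-tight j f≤step (≤-reflexive (trans (∑-step false j p<j q<j) (sym Σf≡2)))
    where
    f≤step : ∀ k → k < j → f k ≤ step false p q k
    f≤step k k<j with k ≟ p
    ... | yes refl = ≤-reflexive (trans fp≡1 (sym (cong₂ _+_ (δ-same k) (δ-other (>⇒≢ q<p)))))
    ... | no k≢p   = ≤-trans (f≤δq-off-p k<j k≢p) (m≤n+m (δ q k) (δ p k))
  by-value 2 fp≡2 k k<j = sym (∑-tight j step≤f (≤-reflexive (trans Σf≡2 (sym (∑-step true j p<j q<j)))) k k<j)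
    where
    step≤f : ∀ k → k < j → step true p q k ≤ f k
    step≤f k k<j with k ≟ p
    ... | yes refl = ≤-reflexive (trans (cong (2 *_) (δ-same k)) (sym fp≡2))
    ... | no k≢p   = ≤-trans (≤-reflexive (cong (2 *_) (δ-other k≢p))) z≤n
  by-value (suc (suc (suc _))) fp≡3+ = contradiction (subst (_≤ 2) fp≡3+ fp≤2) λ { (s≤s (s≤s ())) }

outSeqℕ : ℕ → ℕ → ℕ
outSeqℕ n k = if k ≡ᵇ 0 then 3 else (if k ≡ᵇ n then 0 else 2)

inSeqℕ : ℕ → ℕ → ℕ
inSeqℕ n k = if k ≡ᵇ 0 then 0 else (if k ≡ᵇ n then 3 else 2)

outSeqℕ-mid : ∀ {n j} → 0 < j → j < n → outSeqℕ n j ≡ 2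
outSeqℕ-mid {n} {suc j} _ j<n = cong (if_then 0 else 2) (dec-false (suc j ≟ n) (<⇒≢ j<n))

outSeqℕ-last : ∀ {n} → 0 < n → outSeqℕ n n ≡ 0
outSeqℕ-last {suc n} _ = cong (if_then 0 else 2) (dec-true (suc n ≟ suc n) refl)

inSeqℕ-mid : ∀ {n j} → 0 < j → j < n → inSeqℕ n j ≡ 2
inSeqℕ-mid {n} {suc j} _ j<n = cong (if_then 3 else 2) (dec-false (suc j ≟ n) (<⇒≢ j<n))

inSeqℕ-last : ∀ {n} → 0 < n → inSeqℕ n n ≡ 3
inSeqℕ-last {suc n} _ = cong (if_then 3 else 2) (dec-true (suc n ≟ suc n) refl)

record IsF3ℕ (n : ℕ) (m : ℕ → ℕ → ℕ) : Set where
  field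
    acyclic : ∀ {i j} → i ≤ n → j ≤ i → m i j ≡ 0
    outdeg-≡ : ∀ {i} → i ≤ n → ∑ (suc n) (m i) ≡ outSeqℕ n i
    indeg-≡ : ∀ {j} → j ≤ n → ∑ (suc n) (λ i → m i j) ≡ inSeqℕ n j

module Construction (n : ℕ) (β : ℕ → Bool) where

  a : ℕ → ℕ
  a zero    = 0
  a (suc k) = next (β (suc k)) k (a k)

  a≤pred : ∀ k → a k ≤ pred k
  a≤pred zero    = z≤n
  a≤pred (suc k) = next-≤ (β (suc k)) ≤-refl (≤-trans (a≤pred k) pred[n]≤n)

  a<suc : ∀ k → a k < suc k
  a<suc k = s≤s (≤-trans (a≤pred k) pred[n]≤n)

  -- cut j i counts the edges from i < j to the vertices ≥ j.
  cut : ℕ → ℕ → ℕ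
  cut zero    i = 0
  cut (suc k) i = δ (a k) i + 2 * δ k i

  middle : ℕ → ℕ → ℕ
  middle zero    i = 0
  middle (suc k) i = step (β (suc k)) k (a k) i

  column : ℕ → ℕ → ℕ
  column j = if j ≡ᵇ n then cut j else middle j

  column-last : column n ≡ cut n
  column-last = cong (if_then cut n else middle n) (dec-true (n ≟ n) refl)

  column-middle : ∀ {j} → j ≢ n → column j ≡ middle j
  column-middle {j} j≢n = cong (if_then cut j else middle j) (dec-false (j ≟ n) j≢n)

  cut-above : ∀ {j i} → j ≤ i → cut j i ≡ 0
  cut-above {zero}  _   = refl
  cut-above {suc k} k<i =
    cong₂ (λ x y → x + 2 * y) (δ-other (>⇒≢ (<-≤-trans (a<suc k) k<i))) (δ-other (>⇒≢ k<i))

  middle-above : ∀ {j i} → j ≤ i → middle j i ≡ 0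
  middle-above {zero}  _   = refl
  middle-above {suc k} k<i = step-zero (β (suc k)) (>⇒≢ k<i) (>⇒≢ (<-≤-trans (a<suc k) k<i))

  column-above : ∀ {j i} → j ≤ i → column j i ≡ 0
  column-above {j} {i} j≤i with j ≟ n
  ... | yes refl = trans (cong-app column-last i) (cut-above j≤i)
  ... | no j≢n   = trans (cong-app (column-middle j≢n) i) (middle-above j≤i)

  ∑-cut : ∀ k → ∑ (suc k) (cut (suc k)) ≡ 3
  ∑-cut k = begin
    ∑ (suc k) (cut (suc k))                           ≡⟨ ∑-+ (suc k) (δ (a k)) (λ i → 2 * δ k i) ⟩
    ∑ (suc k) (δ (a k)) + ∑ (suc k) (λ i → 2 * δ k i) ≡⟨ cong (∑ (suc k) (δ (a k)) +_) (∑-*ˡ (suc k) 2 (δ k)) ⟩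
    ∑ (suc k) (δ (a k)) + 2 * ∑ (suc k) (δ k)         ≡⟨ cong₂ (λ x y → x + 2 * y) Σδa≡1 Σδk≡1 ⟩
    3                                                 ∎
    where
    open ≡-Reasoning
    Σδa≡1 : ∑ (suc k) (δ (a k)) ≡ 1
    Σδa≡1 = ∑-δ (suc k) (a<suc k)
    Σδk≡1 : ∑ (suc k) (δ k) ≡ 1
    Σδk≡1 = ∑-δ (suc k) (n<1+n k)

  ∑-middle : ∀ k → ∑ (suc k) (middle (suc k)) ≡ 2
  ∑-middle k = ∑-step (β (suc k)) (suc k) (n<1+n k) (a<suc k)

  middle-+-cut : ∀ k {i} → i < suc k → middle (suc k) i + cut (suc (suc k)) i ≡ cut (suc k) i
  middle-+-cut k {i} i<1+k = begin
    step b k (a k) i + (δ (next b k (a k)) i + 2 * δ (suc k) i) ≡⟨ cong (λ x → step b k (a k) i + x) drop-k+1 ⟩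
    step b k (a k) i + δ (next b k (a k)) i                     ≡⟨ step-+-next b k (a k) i ⟩
    δ (a k) i + 2 * δ k i                                       ∎
    where
    open ≡-Reasoning
    b : Bool
    b = β (suc k)
    drop-k+1 : δ (next b k (a k)) i + 2 * δ (suc k) i ≡ δ (next b k (a k)) i
    drop-k+1 = trans (cong (λ x → δ (next b k (a k)) i + 2 * x) (δ-other (<⇒≢ i<1+k))) (+-identityʳ _)

  cut-diag : ∀ {k} → k < n → cut (suc k) k ≡ outSeqℕ n k
  cut-diag {zero}  _     = refl
  cut-diag {suc k} 1+k<n = begin
    δ (a (suc k)) (suc k) + 2 * δ (suc k) (suc k) ≡⟨ cong₂ (λ x y → x + 2 * y) (δ-other k+1≢a) (δ-same (suc k)) ⟩
    2                                             ≡⟨ outSeqℕ-mid (s≤s z≤n) 1+k<n ⟨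
    outSeqℕ n (suc k)                             ∎
    where
    open ≡-Reasoning
    k+1≢a : suc k ≢ a (suc k)
    k+1≢a = >⇒≢ (s≤s (a≤pred (suc k)))

  edges : ℕ → ℕ → ℕ
  edges i j = column j i

  column-+-cut : ∀ {j i} → j < n → i < j → column j i + cut (suc j) i ≡ cut j i
  column-+-cut {suc k} {i} 1+k<n i<1+k =
    trans (cong (λ c → c i + cut (suc (suc k)) i) (column-middle (<⇒≢ 1+k<n))) (middle-+-cut k i<1+k)

  row-+-cut : ∀ j → j ≤ n → ∀ {i} → i < j → ∑ j (edges i) + cut j i ≡ outSeqℕ n i
  row-+-cut (suc k) k<n {i} i<1+k with m<1+n⇒m<n∨m≡n i<1+k
  ... | inj₁ i<k = begin
    (∑ k (edges i) + column k i) + cut (suc k) i ≡⟨ +-assoc (∑ k (edges i)) (column k i) (cut (suc k) i) ⟩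
    ∑ k (edges i) + (column k i + cut (suc k) i) ≡⟨ cong (∑ k (edges i) +_) (column-+-cut k<n i<k) ⟩
    ∑ k (edges i) + cut k i                      ≡⟨ row-+-cut k (<⇒≤ k<n) i<k ⟩
    outSeqℕ n i                                  ∎
    where open ≡-Reasoning
  ... | inj₂ refl = begin
    (∑ k (edges k) + column k k) + cut (suc k) k ≡⟨ cong₂ (λ x y → (x + y) + cut (suc k) k) row-below-k diagonal ⟩
    cut (suc k) k                                ≡⟨ cut-diag k<n ⟩
    outSeqℕ n k                                  ∎
    where
    open ≡-Reasoning
    row-below-k : ∑ k (edges k) ≡ 0
    row-below-k = ∑-zero k (λ l l<k → column-above (<⇒≤ l<k))
    diagonal : column k k ≡ 0
    diagonal = column-above {k} ≤-refl

  ∑-column : ∀ {j} → j ≤ n → ∑ j (column j) ≡ inSeqℕ n j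
  ∑-column {zero}  _     = refl
  ∑-column {suc k} 1+k≤n with suc k ≟ n
  ... | yes refl = trans (cong (∑ (suc k)) column-last) (trans (∑-cut k) (sym (inSeqℕ-last {suc k} (s≤s z≤n))))
  ... | no 1+k≢n = trans (cong (∑ (suc k)) (column-middle 1+k≢n))
                         (trans (∑-middle k) (sym (inSeqℕ-mid (s≤s z≤n) (≤∧≢⇒< 1+k≤n 1+k≢n))))

  edges-isF3ℕ : 0 < n → IsF3ℕ n edges
  edges-isF3ℕ 0<n = record
    { acyclic  = λ _ j≤i → column-above j≤i
    ; outdeg-≡ = outdeg-≡
    ; indeg-≡  = λ {j} j≤n →
        trans (∑-prefix (suc n) (column j) (m≤n⇒m≤1+n j≤n) (λ _ j≤k _ → column-above j≤k)) (∑-column j≤n)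
    }
    where
    outdeg-≡ : ∀ {i} → i ≤ n → ∑ (suc n) (edges i) ≡ outSeqℕ n i
    outdeg-≡ {i} i≤n with m≤n⇒m<n∨m≡n i≤n
    ... | inj₁ i<n  = trans (cong (∑ n (edges i) +_) (cong-app column-last i)) (row-+-cut n ≤-refl i<n)
    ... | inj₂ refl = trans (∑-zero (suc n) (λ k k<1+n → column-above (≤-pred k<1+n))) (sym (outSeqℕ-last 0<n))

  edges-readback : ∀ k → suc (suc k) < n → (edges (suc k) (suc (suc k)) ≡ᵇ 2) ≡ β (suc (suc k))
  edges-readback k 2+k<n =
    trans (cong (λ c → c (suc k) ≡ᵇ 2) (column-middle (<⇒≢ 2+k<n)))
          (step-readback (β (suc (suc k))) (<⇒≢ (s≤s (a≤pred (suc k)))))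

module Reconstruction {n : ℕ} {m : ℕ → ℕ → ℕ} (valid : IsF3ℕ n m) (β : ℕ → Bool)
  (consistent : ∀ k → suc (suc k) < n → β (suc (suc k)) ≡ (m (suc k) (suc (suc k)) ≡ᵇ 2)) where
  open IsF3ℕ valid
  open Construction n β

  ∑-in-column : ∀ {j} → j ≤ n → ∑ j (λ i → m i j) ≡ inSeqℕ n j
  ∑-in-column {j} j≤n =
    trans (sym (∑-prefix (suc n) (λ i → m i j) (m≤n⇒m≤1+n j≤n) (λ _ j≤k k<1+n → acyclic (≤-pred k<1+n) j≤k)))
          (indeg-≡ j≤n)

  AgreeBelow : ℕ → Set
  AgreeBelow j = ∀ {i k} → i ≤ n → k < j → m i k ≡ edges i k

  -- Once the earlier columns agree, the out-degree that i has left for the vertices ≥ j is cut j i.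
  ≤-cut : ∀ {j i} → j ≤ n → AgreeBelow j → i < j → m i j ≤ cut j i
  ≤-cut {j} {i} j≤n agree i<j = +-cancelˡ-≤ (∑ j (m i)) (m i j) (cut j i) (begin
    ∑ j (m i) + m i j       ≤⟨ ∑-prefix-≤ (suc n) (m i) (s≤s j≤n) ⟩
    ∑ (suc n) (m i)         ≡⟨ outdeg-≡ i≤n ⟩
    outSeqℕ n i             ≡⟨ row-+-cut j j≤n i<j ⟨
    ∑ j (edges i) + cut j i ≡⟨ cong (_+ cut j i) (∑-cong j (λ k k<j → agree i≤n k<j)) ⟨
    ∑ j (m i) + cut j i     ∎)
    where
    open ≤-Reasoning
    i≤n : i ≤ n
    i≤n = <⇒≤ (<-≤-trans i<j j≤n)

  column-agrees : ∀ {j} → j ≤ n → AgreeBelow j → ∀ {i} → i < j → m i j ≡ column j i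
  column-agrees {suc k} 1+k≤n agree {i} i<1+k with suc k ≟ n
  ... | yes refl = trans (∑-tight n (λ i i<n → ≤-cut ≤-refl agree i<n) Σcut≤Σcolumn i i<1+k)
                         (sym (cong-app column-last i))
    where
    Σcut≤Σcolumn : ∑ n (cut n) ≤ ∑ n (λ i → m i n)
    Σcut≤Σcolumn =
      ≤-reflexive (trans (∑-cut k) (trans (sym (inSeqℕ-last {n} (s≤s z≤n))) (sym (∑-in-column ≤-refl))))
  column-agrees {1}           1≤n agree {zero} _ | no 1≢n =
    trans (trans (∑-in-column 1≤n) (inSeqℕ-mid (s≤s z≤n) (≤∧≢⇒< 1≤n 1≢n)))
          (sym (trans (cong-app (column-middle 1≢n) 0) (step-same (β 1) 0)))
  column-agrees {1}           _   _     {suc _} (s≤s ()) | no _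
  column-agrees {suc (suc k)} j≤n agree {i} i<j | no j≢n = begin
    m i j                    ≡⟨ step-of-≤-cut (n<1+n p) (s≤s (a≤pred p)) (λ _ → ≤-cut j≤n agree) Σcolumn≡2 i i<j ⟩
    step (m p j ≡ᵇ 2) p q i  ≡⟨ cong (λ b → step b p q i) (consistent k (≤∧≢⇒< j≤n j≢n)) ⟨
    middle j i                ≡⟨ cong-app (column-middle j≢n) i ⟨
    column j i               ∎
    where
    open ≡-Reasoning
    j p q : ℕ
    j = suc (suc k)
    p = suc k
    q = a (suc k)
    Σcolumn≡2 : ∑ j (λ i → m i j) ≡ 2
    Σcolumn≡2 = trans (∑-in-column j≤n) (inSeqℕ-mid (s≤s z≤n) (≤∧≢⇒< j≤n j≢n))

  agree-below : ∀ j → j ≤ suc n → AgreeBelow j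
  agree-below (suc j) 1+j≤1+n {i} {k} i≤n k<1+j with m<1+n⇒m<n∨m≡n k<1+j
  ... | inj₁ k<j  = agree-below j (m≤n⇒m≤1+n (≤-pred 1+j≤1+n)) i≤n k<j
  ... | inj₂ refl with i <? k
  ...   | yes i<k = column-agrees (≤-pred 1+j≤1+n) (agree-below k (m≤n⇒m≤1+n (≤-pred 1+j≤1+n))) i<k
  ...   | no i≮k  = trans (acyclic i≤n (≮⇒≥ i≮k)) (sym (column-above (≮⇒≥ i≮k)))

  reconstruct : ∀ {i j} → i ≤ n → j ≤ n → m i j ≡ edges i j
  reconstruct i≤n j≤n = agree-below (suc n) ≤-refl i≤n (s≤s j≤n)

clamp : (n k : ℕ) → Fin (suc n)
clamp zero    k       = Fin.zero
clamp (suc n) zero    = Fin.zero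
clamp (suc n) (suc k) = Fin.suc (clamp n k)

toℕ-clamp : ∀ {n k} → k ≤ n → toℕ (clamp n k) ≡ k
toℕ-clamp {zero}  {zero}  _         = refl
toℕ-clamp {suc n} {zero}  _         = refl
toℕ-clamp {suc n} {suc k} (s≤s k≤n) = cong suc (toℕ-clamp k≤n)

clamp-toℕ : ∀ {n} (x : Fin (suc n)) → clamp n (toℕ x) ≡ x
clamp-toℕ {zero}  Fin.zero    = refl
clamp-toℕ {suc n} Fin.zero    = refl
clamp-toℕ {suc n} (Fin.suc x) = cong Fin.suc (clamp-toℕ x)

matrix : ∀ {n} → EdgeMult n → ℕ → ℕ → ℕ
matrix {n} M i j = M (clamp n i) (clamp n j)

matrix-toℕ : ∀ {n} (M : EdgeMult n) x y → matrix M (toℕ x) (toℕ y) ≡ M x y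
matrix-toℕ M x y = cong₂ M (clamp-toℕ x) (clamp-toℕ y)

sum-tabulate-clamp : ∀ {n} (g : Fin (suc n) → ℕ) → sum (tabulate g) ≡ ∑ (suc n) (g ∘ clamp n)
sum-tabulate-clamp {n} g =
  trans (cong sum (Vecₚ.tabulate-cong (λ x → cong g (sym (clamp-toℕ x))))) (∑-tabulate (suc n) (g ∘ clamp n))

matrix-isF3ℕ : ∀ {n M} → IsF3 n M → IsF3ℕ n (matrix M)
matrix-isF3ℕ {n} {M} (acyclic , outdeg-≡ , indeg-≡) = record
  { acyclic  = λ {i} {j} i≤n j≤i →
      acyclic (clamp n i) (clamp n j) (subst₂ _≤_ (sym (toℕ-clamp (≤-trans j≤i i≤n))) (sym (toℕ-clamp i≤n)) j≤i)
  ; outdeg-≡ = λ {i} i≤n →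
      trans (sym (sum-tabulate-clamp (M (clamp n i))))
            (trans (outdeg-≡ (clamp n i)) (cong (outSeqℕ n) (toℕ-clamp i≤n)))
  ; indeg-≡  = λ {j} j≤n →
      trans (sym (sum-tabulate-clamp (λ x → M x (clamp n j))))
            (trans (indeg-≡ (clamp n j)) (cong (inSeqℕ n) (toℕ-clamp j≤n)))
  }

toEdgeMult : ∀ {n} → (ℕ → ℕ → ℕ) → EdgeMult n
toEdgeMult m x y = m (toℕ x) (toℕ y)

toEdgeMult-isF3 : ∀ {n m} → IsF3ℕ n m → IsF3 n (toEdgeMult m)
toEdgeMult-isF3 {n} {m} valid =
    (λ x y y≤x → acyclic (Finₚ.toℕ≤pred[n] x) y≤x)
  , (λ x → trans (∑-tabulate (suc n) (m (toℕ x))) (outdeg-≡ (Finₚ.toℕ≤pred[n] x)))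
  , (λ y → trans (∑-tabulate (suc n) (λ i → m i (toℕ y))) (indeg-≡ (Finₚ.toℕ≤pred[n] y)))
  where open IsF3ℕ valid

-- Out of range, bitAt returns the junk value false.
bitAt : ∀ {l} → Vec Bool l → ℕ → Bool
bitAt []       _       = false
bitAt (b ∷ _)  zero    = b
bitAt (_ ∷ bs) (suc k) = bitAt bs k

bitAt-tabulate : ∀ {l} (g : ℕ → Bool) {k} → k < l → bitAt (tabulate {n = l} (g ∘ toℕ)) k ≡ g k
bitAt-tabulate {suc l} g {zero}  _         = refl
bitAt-tabulate {suc l} g {suc k} (s≤s k<l) = bitAt-tabulate (g ∘ suc) k<l

tabulate-bitAt : ∀ {l} (v : Vec Bool l) → tabulate (bitAt v ∘ toℕ) ≡ v
tabulate-bitAt []       = refl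
tabulate-bitAt (b ∷ bs) = cong (b ∷_) (tabulate-bitAt bs)

-- Bit k of a string is the choice made at vertex k + 2.
module Bijection (n' : ℕ) where
  n : ℕ
  n = suc (suc n')

  choice : Vec Bool n' → ℕ → Bool
  choice v j = bitAt v (j ∸ 2)

  encode : F3 n → Vec Bool n'
  encode (M , _) = tabulate (λ k → matrix M (suc (toℕ k)) (suc (suc (toℕ k))) ≡ᵇ 2)

  decode : Vec Bool n' → F3 n
  decode v = toEdgeMult edges , toEdgeMult-isF3 (edges-isF3ℕ (s≤s z≤n))
    where open Construction n (choice v)

  encode-cong : ∀ x y → x ≈F y → encode x ≡ encode y
  encode-cong x y x≈y = Vecₚ.tabulate-cong (λ k → cong (_≡ᵇ 2) (x≈y _ _))

  decode-encode : ∀ x → x ≈F decode (encode x)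
  decode-encode x@(M , isF3) i j = begin
    M i j                           ≡⟨ matrix-toℕ M i j ⟨
    matrix M (toℕ i) (toℕ j)        ≡⟨ reconstruct (Finₚ.toℕ≤pred[n] i) (Finₚ.toℕ≤pred[n] j) ⟩
    proj₁ (decode (encode x)) i j   ∎
    where
    open ≡-Reasoning
    open Reconstruction (matrix-isF3ℕ isF3) (choice (encode x))
      (λ k 2+k<n → bitAt-tabulate (λ k → matrix M (suc k) (suc (suc k)) ≡ᵇ 2) (≤-pred (≤-pred 2+k<n)))

  encode-injective : ∀ x y → encode x ≡ encode y → x ≈F y
  encode-injective x y eq i j = begin
    proj₁ x i j                     ≡⟨ decode-encode x i j ⟩
    proj₁ (decode (encode x)) i j   ≡⟨ cong (λ v → proj₁ (decode v) i j) eq ⟩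
    proj₁ (decode (encode y)) i j   ≡⟨ decode-encode y i j ⟨
    proj₁ y i j                     ∎
    where open ≡-Reasoning

  encode-decode : ∀ v → encode (decode v) ≡ v
  encode-decode v = trans (Vecₚ.tabulate-cong readback) (tabulate-bitAt v)
    where
    open Construction n (choice v)
    readback : ∀ k → (matrix (toEdgeMult {n} edges) (suc (toℕ k)) (suc (suc (toℕ k))) ≡ᵇ 2) ≡ bitAt v (toℕ k)
    readback k = trans (cong₂ (λ i j → edges i j ≡ᵇ 2) (toℕ-clamp 1+k≤n) (toℕ-clamp (<⇒≤ 2+k<n)))
                       (edges-readback (toℕ k) 2+k<n)
      where
      2+k<n : suc (suc (toℕ k)) < n
      2+k<n = s≤s (s≤s (Finₚ.toℕ<n k))
      1+k≤n : suc (toℕ k) ≤ n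
      1+k≤n = <⇒≤ (<-trans (n<1+n _) 2+k<n)

theorem3p4 : (n : ℕ) → 2 ≤ n →
    Σ (F3 n → Vec Bool (n ∸ 2)) λ f →
      (∀ x y → x ≈F y → f x ≡ f y)
      × (∀ x y → f x ≡ f y → x ≈F y)
      × (∀ v → ∃ λ x → f x ≡ v)
theorem3p4 (suc (suc n')) (s≤s (s≤s z≤n)) =
  encode , encode-cong , encode-injective , λ v → decode v , encode-decode v
  where open Bijection n'
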